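{- Let $\mathbf{A}$ be a commutative bimonoid and let $\iota\colon\mathbf{A}\hookrightarrow\overline{\mathbf{A}}$ be a commutative $\Delta_1$-extension of $\mathbf{A}$. Then for every bimonoid $\mathbf{B}$ and every homomorphism of bimonoids $h\colon\overline{\mathbf{A}}\to\mathbf{B}$ such that $h\circ\iota$ is an embedding, $h$ is itself an embedding.
   Context: A bimonoid $\langle A,\leq,\cdot,1,+,0\rangle$ is a poset with two monoid structures ($\cdot$ with unit $1$, $+$ with unit $0$), both operations order preserving in each argument with respect to $\leq$, satisfying hemidistributivity $x\cdot(y+z)\leq(x\cdot y)+z$ and $(z+y)\cdot x\leq z+(y\cdot x)$; it is commutative if both operations are commutative. A homomorphism of bimonoids is an order-preserving map preserving $\cdot,1,+,0$; an embedding is a homomorphism that is an order embedding. In a commutative bimonoid, $y$ is a complement of $x$ if $x\cdot y\leq 0$ and $1\leq x+y$; complements are unique when they exist and the complement of $x$ is written $\overline{x}$. An embedding $\iota\colon\mathbf{A}\hookrightarrow\mathbf{B}$ of commutative bimonoids is a commutative $\Delta_1$-extension if the elements of the form $\iota(a)\cdot\overline{\iota(b)}$ ($a,b\in\mathbf{A}$, the complement existing in $\mathbf{B}$) are join dense in $\mathbf{B}$ (every element of $\mathbf{B}$ is the join of a set of such elements) and the elements of the form $\iota(a)+\overline{\iota(b)}$ are meet dense in $\mathbf{B}$. -}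

module Defs where

open import Level using (Level; suc; _⊔_) renaming (zero to lzero)
open import Data.Product using (Σ; _×_; _,_; ∃; ∃-syntax)
open import Relation.Binary.PropositionalEquality using (_≡_)
open import Relation.Binary.Structures using (IsPartialOrder)

record Bimonoid : Set₁ where
  infix  4 _≤_
  infixl 7 _·_
  infixl 6 _+_
  field
    Carrier : Set
    _≤_     : Carrier → Carrier → Set
    _·_     : Carrier → Carrier → Carrier
    𝟙       : Carrier
    _+_     : Carrier → Carrier → Carrier
    𝟘       : Carrier
    isPartialOrder : IsPartialOrder _≡_ _≤_
    ·-assoc : ∀ x y z → (x · y) · z ≡ x · (y · z)
    ·-identityˡ : ∀ x → 𝟙 · x ≡ x
    ·-identityʳ : ∀ x → x · 𝟙 ≡ x
    +-assoc : ∀ x y z → (x + y) + z ≡ x + (y + z)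
    +-identityˡ : ∀ x → 𝟘 + x ≡ x
    +-identityʳ : ∀ x → x + 𝟘 ≡ x
    ·-mono : ∀ {x x' y y'} → x ≤ x' → y ≤ y' → x · y ≤ x' · y'
    +-mono : ∀ {x x' y y'} → x ≤ x' → y ≤ y' → x + y ≤ x' + y'
    hemidistribˡ : ∀ x y z → x · (y + z) ≤ (x · y) + z
    hemidistribʳ : ∀ x y z → (z + y) · x ≤ z + (y · x)

IsCommutative : Bimonoid → Set
IsCommutative A = (∀ x y → x · y ≡ y · x) × (∀ x y → x + y ≡ y + x)
  where open Bimonoid A

record IsHomomorphism (A B : Bimonoid) (h : Bimonoid.Carrier A → Bimonoid.Carrier B) : Set where
  private
    module A = Bimonoid A
    module B = Bimonoid B
  field
    mono  : ∀ {x y} → x A.≤ y → h x B.≤ h y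
    hom-· : ∀ x y → h (x A.· y) ≡ h x B.· h y
    hom-𝟙 : h A.𝟙 ≡ B.𝟙
    hom-+ : ∀ x y → h (x A.+ y) ≡ h x B.+ h y
    hom-𝟘 : h A.𝟘 ≡ B.𝟘

record IsEmbedding (A B : Bimonoid) (h : Bimonoid.Carrier A → Bimonoid.Carrier B) : Set where
  field
    isHomomorphism : IsHomomorphism A B h
    reflects       : ∀ {x y} → Bimonoid._≤_ B (h x) (h y) → Bimonoid._≤_ A x y

IsComplement : (B : Bimonoid) → Bimonoid.Carrier B → Bimonoid.Carrier B → Set
IsComplement B x y = (x · y ≤ 𝟘) × (𝟙 ≤ x + y)
  where open Bimonoid B

IsJoin : (B : Bimonoid) → (Bimonoid.Carrier B → Set) → Bimonoid.Carrier B → Set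
IsJoin B S x = (∀ s → S s → s ≤ x) × (∀ u → (∀ s → S s → s ≤ u) → x ≤ u)
  where open Bimonoid B

IsMeet : (B : Bimonoid) → (Bimonoid.Carrier B → Set) → Bimonoid.Carrier B → Set
IsMeet B S x = (∀ s → S s → x ≤ s) × (∀ u → (∀ s → S s → u ≤ s) → u ≤ x)
  where open Bimonoid B

IsJoinGenerator : (A B : Bimonoid) → (Bimonoid.Carrier A → Bimonoid.Carrier B) → Bimonoid.Carrier B → Set
IsJoinGenerator A B ι x =
  ∃[ a ] ∃[ b ] ∃[ c ] (IsComplement B (ι b) c × (x ≡ ι a · c))
  where open Bimonoid B

IsMeetGenerator : (A B : Bimonoid) → (Bimonoid.Carrier A → Bimonoid.Carrier B) → Bimonoid.Carrier B → Set
IsMeetGenerator A B ι x =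
  ∃[ a ] ∃[ b ] ∃[ c ] (IsComplement B (ι b) c × (x ≡ ι a + c))
  where open Bimonoid B

record IsCommΔ₁Extension (A B : Bimonoid) (ι : Bimonoid.Carrier A → Bimonoid.Carrier B) : Set₁ where
  field
    commA       : IsCommutative A
    commB       : IsCommutative B
    isEmbedding : IsEmbedding A B ι
    joinDense   : ∀ x → Σ (Bimonoid.Carrier B → Set) λ S →
                    (∀ s → S s → IsJoinGenerator A B ι s) × IsJoin B S x
    meetDense   : ∀ x → Σ (Bimonoid.Carrier B → Set) λ S →
                    (∀ s → S s → IsMeetGenerator A B ι s) × IsMeet B S x

{-# OPTIONS --safe #-}
module Submission where

-- Write x̄ for a complement of x. In a commutative bimonoid, complements let a
-- factor be moved across an inequality: a · c̄ ≤ a' + c̄' holds iff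
-- a · c' ≤ a' + c, and the hemidistributive laws give both directions using
-- only x ≤ x · (c̄ + c) and c̄' · c' ≤ 0. Homomorphisms preserve complements, so
-- h(ι a · c̄) ≤ h(ι a' + c̄') transposes in B to h(ι(a · c')) ≤ h(ι(a' + c)),
-- which h ∘ ι reflects, and transposing back gives ι a · c̄ ≤ ι a' + c̄' in Ā.
-- B need not be commutative: the one commutation the transposition uses there
-- is the image under h of one in Ā.
-- Join and meet density then extend reflection from generators to all of Ā.

open import Defs
open import Function using (_∘_)
open import Data.Product using (_,_; proj₁; proj₂)
open import Relation.Binary.Bundles using (Poset)
open import Relation.Binary.PropositionalEquality
  using (_≡_; refl; sym; cong; subst₂)
open import Relation.Binary.Structures using (IsPartialOrder)
import Relation.Binary.Reasoning.PartialOrder as PosetReasoning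

module BimonoidProperties (M : Bimonoid) where
  open Bimonoid M
  open IsPartialOrder isPartialOrder public
    using () renaming (refl to ≤-refl; trans to ≤-trans)

  poset : Poset _ _ _
  poset = record { isPartialOrder = isPartialOrder }

  open PosetReasoning poset

  ·-≤-+⇒≤-+ : ∀ {x q z r} → x · q ≤ z → 𝟙 ≤ q + r → x ≤ z + r
  ·-≤-+⇒≤-+ {x} {q} {z} {r} xq≤z 𝟙≤q+r = begin
    x             ≡⟨ ·-identityʳ x ⟨
    x · 𝟙         ≤⟨ ·-mono ≤-refl 𝟙≤q+r ⟩
    x · (q + r)   ≤⟨ hemidistribˡ x q r ⟩
    x · q + r     ≤⟨ +-mono xq≤z ≤-refl ⟩
    z + r         ∎

  ≤-+⇒·-≤ : ∀ {x z s t} → x ≤ z + s → s · t ≤ 𝟘 → x · t ≤ z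
  ≤-+⇒·-≤ {x} {z} {s} {t} x≤z+s st≤𝟘 = begin
    x · t         ≤⟨ ·-mono x≤z+s ≤-refl ⟩
    (z + s) · t   ≤⟨ hemidistribʳ t s z ⟩
    z + s · t     ≤⟨ +-mono ≤-refl st≤𝟘 ⟩
    z + 𝟘         ≡⟨ +-identityʳ z ⟩
    z             ∎

  transpose-complements : ∀ {x y b c b' c'} →
    IsComplement M c b → IsComplement M c' b' → c' + b ≡ b + c' →
    x · c ≤ y + c' → x · b' ≤ y + b
  transpose-complements {x} {y} {b} {c} {b'} {c'}
    (_ , 𝟙≤c+b) (c'b'≤𝟘 , _) c'+b≡b+c' xc≤y+c' =
    ≤-+⇒·-≤ x≤y+b+c' c'b'≤𝟘
    where
    x≤y+b+c' : x ≤ y + b + c'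
    x≤y+b+c' = begin
      x              ≤⟨ ·-≤-+⇒≤-+ xc≤y+c' 𝟙≤c+b ⟩
      y + c' + b     ≡⟨ +-assoc y c' b ⟩
      y + (c' + b)   ≡⟨ cong (y +_) c'+b≡b+c' ⟩
      y + (b + c')   ≡⟨ +-assoc y b c' ⟨
      y + b + c'     ∎

  join≤meet : ∀ {S T x y} → IsJoin M S x → IsMeet M T y →
    (∀ s t → S s → T t → s ≤ t) → x ≤ y
  join≤meet (_ , x-least) (_ , y-greatest) S≤T =
    x-least _ λ s Ss → y-greatest s λ t Tt → S≤T s t Ss Tt

complement-sym : ∀ M → IsCommutative M → ∀ {x y} →
  IsComplement M x y → IsComplement M y x
complement-sym M (·-comm , +-comm) {x} {y} (xy≤𝟘 , 𝟙≤x+y) =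
  subst₂ _≤_ (·-comm x y) refl xy≤𝟘 , subst₂ _≤_ refl (+-comm x y) 𝟙≤x+y
  where open Bimonoid M

module HomomorphismProperties
  {A B : Bimonoid} {h : Bimonoid.Carrier A → Bimonoid.Carrier B}
  (hom : IsHomomorphism A B h) where
  private
    module A = Bimonoid A
    module B = Bimonoid B
  open IsHomomorphism hom public

  preserves-complement : ∀ {x y} →
    IsComplement A x y → IsComplement B (h x) (h y)
  preserves-complement {x} {y} (xy≤𝟘 , 𝟙≤x+y) =
    subst₂ B._≤_ (hom-· x y) hom-𝟘 (mono xy≤𝟘) ,
    subst₂ B._≤_ hom-𝟙 (hom-+ x y) (mono 𝟙≤x+y)

  ·-≤-+-hom : ∀ {x y u v} → h (x A.· y) B.≤ h (u A.+ v) →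
    h x B.· h y B.≤ h u B.+ h v
  ·-≤-+-hom {x} {y} {u} {v} = subst₂ B._≤_ (hom-· x y) (hom-+ u v)

  ·-≤-+-unhom : ∀ {x y u v} → h x B.· h y B.≤ h u B.+ h v →
    h (x A.· y) B.≤ h (u A.+ v)
  ·-≤-+-unhom {x} {y} {u} {v} =
    subst₂ B._≤_ (sym (hom-· x y)) (sym (hom-+ u v))

module _ {A Ā : Bimonoid} {ι : Bimonoid.Carrier A → Bimonoid.Carrier Ā}
  (ext : IsCommΔ₁Extension A Ā ι)
  {B : Bimonoid} {h : Bimonoid.Carrier Ā → Bimonoid.Carrier B}
  (hom : IsHomomorphism Ā B h) (h∘ι-emb : IsEmbedding A B (h ∘ ι)) where
  private
    module Ā = Bimonoid Ā
    module B = Bimonoid B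
    open IsCommΔ₁Extension ext
    module ι = HomomorphismProperties (IsEmbedding.isHomomorphism isEmbedding)
    module h∘ι = IsEmbedding h∘ι-emb
    module h∘ι-hom = HomomorphismProperties h∘ι.isHomomorphism
    open HomomorphismProperties hom

  reflects-generators : ∀ {s t} →
    IsJoinGenerator A Ā ι s → IsMeetGenerator A Ā ι t →
    h s B.≤ h t → s Ā.≤ t
  reflects-generators (a , b , c , b̄c , refl) (a' , b' , c' , b̄'c' , refl) hs≤ht =
    BimonoidProperties.transpose-complements Ā b̄'c' b̄c (proj₂ commB _ _) ιa·ιb'≤ιa'+ιb
    where
    complement-image : ∀ {x y} → IsComplement Ā x y → IsComplement B (h y) (h x)
    complement-image = preserves-complement ∘ complement-sym Ā commB

    hc'+hιb-comm : h c' B.+ h (ι b) ≡ h (ι b) B.+ h c'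
    hc'+hιb-comm =
      subst₂ _≡_ (hom-+ c' (ι b)) (hom-+ (ι b) c') (cong h (proj₂ commB c' (ι b)))

    hιa·hιb'≤hιa'+hιb : h (ι a) B.· h (ι b') B.≤ h (ι a') B.+ h (ι b)
    hιa·hιb'≤hιa'+hιb = BimonoidProperties.transpose-complements B
      (complement-image b̄c) (complement-image b̄'c') hc'+hιb-comm (·-≤-+-hom hs≤ht)

    ιa·ιb'≤ιa'+ιb : ι a Ā.· ι b' Ā.≤ ι a' Ā.+ ι b
    ιa·ιb'≤ιa'+ιb = ι.·-≤-+-hom
      (ι.mono (h∘ι.reflects (h∘ι-hom.·-≤-+-unhom hιa·hιb'≤hιa'+hιb)))

  h-reflects-≤ : ∀ {x y} → h x B.≤ h y → x Ā.≤ y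
  h-reflects-≤ {x} {y} hx≤hy with joinDense x | meetDense y
  ... | S , S-gen , x-join | T , T-gen , y-meet =
    BimonoidProperties.join≤meet Ā x-join y-meet λ s t Ss Tt →
      reflects-generators (S-gen s Ss) (T-gen t Tt)
        (≤-trans (mono (proj₁ x-join s Ss)) (≤-trans hx≤hy (mono (proj₁ y-meet t Tt))))
    where open BimonoidProperties B using (≤-trans)

mainTheorem4 : (A Ā : Bimonoid) → IsCommutative A →
    (ι : Bimonoid.Carrier A → Bimonoid.Carrier Ā) → IsCommΔ₁Extension A Ā ι →
    (B : Bimonoid) (h : Bimonoid.Carrier Ā → Bimonoid.Carrier B) →
    IsHomomorphism Ā B h → IsEmbedding A B (h ∘ ι) → IsEmbedding Ā B h
mainTheorem4 A Ā _ ι ext B h hom h∘ι-emb = record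
  { isHomomorphism = hom
  ; reflects       = h-reflects-≤ ext hom h∘ι-emb
  }
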